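{- Let $G$ be a finite group acting simply on a finite set $X$, with set of $G$-orbits ${\bf O}$. The set of assembly trees for $X$ produced by the following recursive procedure (over all possible choices) is exactly the set of assembly trees for $X$ that are fixed by $G$. Procedure: (1) Choose a partition $\Pi=\{\pi_1,\dots,\pi_k\}$ of ${\bf O}$. (2) For each $i=1,\dots,k$ choose a subgroup $H_i\le G$; if $k=1$, the choice $H_1=G$ is not allowed. (3) For each $i$, choose a single orbit of $H_i$ acting on each $G$-orbit in $\pi_i$, and let $Q_i$ be the union of these $H_i$-orbits. (4) Recursively, for each $i$ let $\tau_{Q_i}$ be any assembly tree whose leaves are labeled by $Q_i$ and which is fixed by $H_i$ (acting on $Q_i$). (5) For each $i$ let $S_i=\{r(\tau_{Q_i}): r\in{\bf C}_{H_i}\}$, where ${\bf C}_{H_i}$ is a set of left coset representatives of $H_i$ in $G$, let $S=\bigcup_{i=1}^kS_i$, and let $\tau$ be the rooted tree whose root's children are the roots of the trees in $S$.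
   Context: An assembly tree for a finite set $Y$ is a rooted tree whose leaves are labeled bijectively by the elements of $Y$ and in which every non-leaf vertex has at least two children; each vertex is identified with the set of labels of its leaf descendants. A group acting on $Y$ acts on assembly trees by relabeling leaves: $g(\tau)$ replaces each leaf label $y$ by $g(y)$; $\tau$ is fixed by a group $H$ if $h(\tau)=\tau$ for all $h\in H$. The action is simple if all point stabilizers are trivial. For $r\in G$ and a tree $\tau$, $r(\tau)$ is the relabeled tree. -}

module Defs where

open import Level using (0ℓ)
open import Data.Nat using (ℕ; _≤_)
open import Data.Fin using (Fin)
open import Data.Unit using (⊤)
open import Data.List using (List; []; _∷_; _++_; map; concatMap; length; allFin)
open import Data.List.Relation.Unary.All using (All)
open import Data.List.Relation.Unary.AllPairs using (AllPairs)
open import Data.List.Membership.Propositional using (_∈_)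
open import Data.List.Relation.Binary.Permutation.Homogeneous using (Permutation)
open import Data.List.Relation.Unary.Unique.Propositional using (Unique)
open import Data.Product using (_×_; ∃; Σ)
open import Relation.Binary.PropositionalEquality using (_≡_)
open import Relation.Unary using (Pred)
open import Relation.Nullary using (¬_)
open import Algebra.Structures using (IsGroup)

-- Rooted trees with labelled leaves (children stored as a list; the
-- order of children is irrelevant, see _≅_ below).

data Tree (A : Set) : Set where
  leaf : A → Tree A
  node : List (Tree A) → Tree A

module _ {A B : Set} (f : A → B) where
  mutual
    mapT : Tree A → Tree B
    mapT (leaf a)  = leaf (f a)
    mapT (node ts) = node (mapTs ts)

    mapTs : List (Tree A) → List (Tree B)
    mapTs []       = []
    mapTs (t ∷ ts) = mapT t ∷ mapTs ts

module _ {A : Set} where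
  mutual
    leaves : Tree A → List A
    leaves (leaf a)  = a ∷ []
    leaves (node ts) = leavesL ts

    leavesL : List (Tree A) → List A
    leavesL []       = []
    leavesL (t ∷ ts) = leaves t ++ leavesL ts

  data Proper : Tree A → Set where
    leaf : ∀ {a} → Proper (leaf a)
    node : ∀ {ts} → 2 ≤ length ts → All Proper ts → Proper (node ts)

  data _≅_ : Tree A → Tree A → Set where
    leaf : ∀ {a} → leaf a ≅ leaf a
    node : ∀ {ts us} → Permutation _≅_ ts us → node ts ≅ node us

  AssemblyTree : Pred A 0ℓ → Tree A → Set
  AssemblyTree Y τ =
    Proper τ × Unique (leaves τ) ×
    (∀ y → Y y → y ∈ leaves τ) × (∀ y → y ∈ leaves τ → Y y)

record FiniteGroup : Set where
  field
    order   : ℕ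
    _∙_     : Fin order → Fin order → Fin order
    ε       : Fin order
    _⁻¹     : Fin order → Fin order
    isGroup : IsGroup _≡_ _∙_ ε _⁻¹

  Carrier : Set
  Carrier = Fin order

  record IsSubgroup (H : Pred Carrier 0ℓ) : Set where
    field
      ε∈H  : H ε
      ∙∈H  : ∀ {g h} → H g → H h → H (g ∙ h)
      ⁻¹∈H : ∀ {g} → H g → H (g ⁻¹)

record SimpleAction (G : FiniteGroup) (n : ℕ) : Set where
  open FiniteGroup G
  field
    act    : Carrier → Fin n → Fin n
    act-ε  : ∀ x → act ε x ≡ x
    act-∙  : ∀ g h x → act (g ∙ h) x ≡ act g (act h x)
    simple : ∀ g x → act g x ≡ x → g ≡ ε

module _ (G : FiniteGroup) {n : ℕ} (A : SimpleAction G n) where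
  open FiniteGroup G
  open SimpleAction A

  FixedBy : Pred Carrier 0ℓ → Tree (Fin n) → Set
  FixedBy H τ = ∀ h → H h → mapT (act h) τ ≅ τ

  -- Q_i: union, over the G-orbits in block i, of the H_i-orbit of the
  -- chosen point (choice i x) in the G-orbit of x
  Qset : {k : ℕ} → (Fin n → Fin k) → (Fin k → Pred Carrier 0ℓ) →
         (Fin k → Fin n → Fin n) → Fin k → Pred (Fin n) 0ℓ
  Qset block H choice i z =
    ∃ λ x → block x ≡ i × ∃ λ h → H i h × act h (choice i x) ≡ z

  record ProcedureData : Set₁ where
    field
      -- (1) partition Π = {π_1..π_k} of the set of G-orbits:
      --     block x = index of the block containing the G-orbit of x
      k              : ℕ
      block          : Fin n → Fin k
      block-inv      : ∀ g x → block (act g x) ≡ block x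
      block-nonempty : ∀ i → ∃ λ x → block x ≡ i
      H              : Fin k → Pred Carrier 0ℓ
      H-subgroup     : ∀ i → IsSubgroup (H i)
      H-proper       : k ≡ 1 → ∀ i → ¬ (∀ g → H i g)
      -- (3) for each G-orbit (in block i) a point of it, whose H_i-orbit is chosen
      choice         : Fin k → Fin n → Fin n
      choice-orbit   : ∀ i x → ∃ λ g → act g x ≡ choice i x
      choice-inv     : ∀ i g x → choice i (act g x) ≡ choice i x
      subtree        : Fin k → Tree (Fin n)
      subtree-tree   : ∀ i → AssemblyTree (Qset block H choice i) (subtree i)
      subtree-fixed  : ∀ i → FixedBy (H i) (subtree i)
      reps           : Fin k → List Carrier
      reps-cover     : ∀ i g → ∃ λ r → r ∈ reps i × H i ((r ⁻¹) ∙ g)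
      reps-distinct  : ∀ i → AllPairs (λ r r' → ¬ H i ((r ⁻¹) ∙ r')) (reps i)

    result : Tree (Fin n)
    result = node (concatMap (λ i → map (λ r → mapT (act r) (subtree i)) (reps i)) (allFin k))

  Produced : Tree (Fin n) → Set₁
  Produced τ = Σ ProcedureData λ D → τ ≅ ProcedureData.result D

  AllG : Pred Carrier 0ℓ
  AllG _ = ⊤

  AllX : Pred (Fin n) 0ℓ
  AllX _ = ⊤

module Submission where

-- In a produced tree, two translates r(τ_{Q_i}) and r′(τ_{Q_i}) of one block that share a leaf differ
-- by an element of H_i, because Q_i meets every G-orbit in a single H_i-orbit and the action is simple;
-- translates from different blocks lie over different G-orbits. So the children of the root have
-- disjoint leaf sets covering X, and, τ_{Q_i} being H_i-fixed, every g ∈ G permutes them up to ≅.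
--
-- Conversely, G permutes the children of the root of a fixed tree. Call two points related when the
-- children containing them lie in one G-orbit; its classes are unions of G-orbits and give Π. In each
-- block pick one child: its setwise stabiliser is H_i, its leaf set is Q_i, and the children of the
-- block are its translates by coset representatives of H_i. A single block with H_1 = G would make
-- that child contain every leaf, which is impossible for a root with two children.

open import Defs
open import Data.Nat using (ℕ; _≤_)
open import Data.Fin using (Fin)
open import Data.Product using (_×_)

open import Level using (0ℓ)
open import Algebra.Bundles using (Group)
open import Algebra.Structures using (IsGroup)
import Algebra.Properties.Group as GroupProperties
open import Data.Nat as Nat using (s≤s; z≤n)
open import Data.Nat.Properties using (≤-trans)
open import Data.Fin using (zero; suc; _≟_)
open import Data.Fin.Properties using (any?)
open import Data.Empty using (⊥-elim)
open import Data.Unit using (tt)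
open import Data.Sum using (inj₁; inj₂)
open import Data.Product using (_,_; proj₁; proj₂; ∃-syntax)
open import Data.List using (List; []; _∷_; _++_; map; concatMap; length; allFin; filter; lookup)
import Data.List.Properties as Listₚ
open import Data.List.Relation.Unary.All as All using (All; []; _∷_)
import Data.List.Relation.Unary.All.Properties as Allₚ
open import Data.List.Relation.Unary.Any as Any using (Any; here; there)
open import Data.List.Relation.Unary.Any.Properties using (lookup-index)
open import Data.List.Relation.Unary.AllPairs as AllPairs using (AllPairs; []; _∷_)
import Data.List.Relation.Unary.AllPairs.Properties as AllPairsₚ
open import Data.List.Relation.Unary.Unique.Propositional using (Unique)
import Data.List.Relation.Unary.Unique.Propositional.Properties as Uniqueₚ
open import Data.List.Relation.Binary.Pointwise using (Pointwise; []; _∷_)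
open import Data.List.Relation.Binary.Permutation.Homogeneous using (Permutation; refl; prep; swap; trans)
import Data.List.Relation.Binary.Permutation.Setoid as SetoidPermutation
import Data.List.Relation.Binary.Permutation.Setoid.Properties as SetoidPermutationProperties
open import Data.List.Relation.Binary.Disjoint.Propositional using (Disjoint)
open import Data.List.Membership.Propositional using (_∈_; find; lose)
open import Data.List.Membership.Propositional.Properties
  using (∈-++⁺ˡ; ∈-++⁺ʳ; ∈-concatMap⁺; ∈-concatMap⁻; ∈-map⁺; ∈-map⁻; ∈-∃++; ∈-AllPairs₂;
         ∈-allFin; ∈-filter⁺; ∈-filter⁻; ∈-lookup; ∈-length)
import Data.List.Membership.Setoid as SetoidMembership
open import Function using (case_of_)
open import Relation.Binary using (Rel; Setoid; IsEquivalence; Reflexive; Symmetric; Transitive; _Respects₂_)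
  renaming (Decidable to Decidable₂)
open import Relation.Binary.PropositionalEquality as ≡ using (_≡_; cong; cong₂; subst)
open import Relation.Nullary using (¬_; yes; no)
open import Relation.Nullary.Decidable using (_×-dec_; _→-dec_)
open import Relation.Unary using (Pred; Decidable; _≐_)

-- Trees up to reordering of children

module _ {A : Set} where

  mutual
    ≅-refl : Reflexive (_≅_ {A})
    ≅-refl {leaf a}  = leaf
    ≅-refl {node ts} = node (refl ≅-refl-≋)

    ≅-refl-≋ : Reflexive (Pointwise (_≅_ {A}))
    ≅-refl-≋ {[]}     = []
    ≅-refl-≋ {t ∷ ts} = ≅-refl ∷ ≅-refl-≋

  mutual
    ≅-sym : Symmetric (_≅_ {A})
    ≅-sym leaf     = leaf
    ≅-sym (node p) = node (≅-sym-↭ p)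

    ≅-sym-↭ : Symmetric (Permutation (_≅_ {A}))
    ≅-sym-↭ (refl pw)      = refl (≅-sym-≋ pw)
    ≅-sym-↭ (prep e p)     = prep (≅-sym e) (≅-sym-↭ p)
    ≅-sym-↭ (swap e e′ p)  = swap (≅-sym e′) (≅-sym e) (≅-sym-↭ p)
    ≅-sym-↭ (trans p q)    = trans (≅-sym-↭ q) (≅-sym-↭ p)

    ≅-sym-≋ : Symmetric (Pointwise (_≅_ {A}))
    ≅-sym-≋ []       = []
    ≅-sym-≋ (e ∷ pw) = ≅-sym e ∷ ≅-sym-≋ pw

  ≅-trans : Transitive (_≅_ {A})
  ≅-trans leaf     leaf     = leaf
  ≅-trans (node p) (node q) = node (trans p q)

  ≅-reflexive : ∀ {s t : Tree A} → s ≡ t → s ≅ t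
  ≅-reflexive ≡.refl = ≅-refl

  node-≅⁻ : ∀ {ts us : List (Tree A)} → node ts ≅ node us → Permutation _≅_ ts us
  node-≅⁻ (node p) = p

  ≅-setoid : Setoid 0ℓ 0ℓ
  ≅-setoid = record
    { Carrier = Tree A ; _≈_ = _≅_
    ; isEquivalence = record { refl = ≅-refl ; sym = ≅-sym ; trans = ≅-trans } }

  module ≅↭ = SetoidPermutation ≅-setoid
  module ≅↭ₚ = SetoidPermutationProperties ≅-setoid
  open SetoidMembership ≅-setoid public using () renaming (_∈_ to _∈≅_)

  leavesL-concatMap : (ts : List (Tree A)) → leavesL ts ≡ concatMap leaves ts
  leavesL-concatMap []       = ≡.refl
  leavesL-concatMap (t ∷ ts) = cong (leaves t ++_) (leavesL-concatMap ts)

  ∈-leavesL⁺ : ∀ {ts t} {z : A} → t ∈ ts → z ∈ leaves t → z ∈ leavesL ts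
  ∈-leavesL⁺ {ts} t∈ts z∈t = subst (_ ∈_) (≡.sym (leavesL-concatMap ts))
    (∈-concatMap⁺ leaves (Any.map (λ { ≡.refl → z∈t }) t∈ts))

  ∈-leavesL⁻ : ∀ {ts} {z : A} → z ∈ leavesL ts → ∃[ t ] t ∈ ts × z ∈ leaves t
  ∈-leavesL⁻ {ts} z∈ts = find (∈-concatMap⁻ leaves (subst (_ ∈_) (leavesL-concatMap ts) z∈ts))

  private
    module ≡↭ = SetoidPermutation (≡.setoid A)
    open ≡↭ using (_↭_)
    module ≡↭ₚ = SetoidPermutationProperties (≡.setoid A)

  mutual
    leaves-↭ : ∀ {s t : Tree A} → s ≅ t → leaves s ↭ leaves t
    leaves-↭ leaf     = ≡↭.↭-refl
    leaves-↭ (node p) = leavesL-↭ p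

    leavesL-↭ : ∀ {ts us} → Permutation (_≅_ {A}) ts us → leavesL ts ↭ leavesL us
    leavesL-↭ (refl pw)                         = leavesL-≋ pw
    leavesL-↭ (prep e p)                        = ≡↭ₚ.++⁺ (leaves-↭ e) (leavesL-↭ p)
    leavesL-↭ {t ∷ t′ ∷ _} {u ∷ u′ ∷ _} (swap e e′ p) = ≡↭.↭-trans
      (≡↭ₚ.++⁺ (leaves-↭ e) (≡↭ₚ.++⁺ (leaves-↭ e′) (leavesL-↭ p))) (≡↭ₚ.shifts (leaves u′) (leaves u))
    leavesL-↭ (trans p q)                       = ≡↭.↭-trans (leavesL-↭ p) (leavesL-↭ q)

    leavesL-≋ : ∀ {ts us} → Pointwise (_≅_ {A}) ts us → leavesL ts ↭ leavesL us
    leavesL-≋ []       = ≡↭.↭-refl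
    leavesL-≋ (e ∷ pw) = ≡↭ₚ.++⁺ (leaves-↭ e) (leavesL-≋ pw)

  ∈-leaves-resp-≅ : ∀ {s t} {z : A} → s ≅ t → z ∈ leaves s → z ∈ leaves t
  ∈-leaves-resp-≅ e = ≡↭ₚ.∈-resp-↭ (leaves-↭ e)

  Unique-leaves-resp-≅ : ∀ {s t : Tree A} → s ≅ t → Unique (leaves s) → Unique (leaves t)
  Unique-leaves-resp-≅ e = ≡↭ₚ.Unique-resp-↭ (leaves-↭ e)

  mutual
    Proper-resp-≅ : ∀ {s t : Tree A} → s ≅ t → Proper s → Proper t
    Proper-resp-≅ leaf     leaf          = leaf
    Proper-resp-≅ (node p) (node 2≤ ps) =
      node (subst (2 ≤_) (≅↭ₚ.xs↭ys⇒|xs|≡|ys| p) 2≤) (All-Proper-resp-↭ p ps)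

    All-Proper-resp-↭ : ∀ {ts us} → Permutation (_≅_ {A}) ts us → All Proper ts → All Proper us
    All-Proper-resp-↭ (refl pw)     ps            = All-Proper-resp-≋ pw ps
    All-Proper-resp-↭ (prep e p)    (q ∷ ps)      = Proper-resp-≅ e q ∷ All-Proper-resp-↭ p ps
    All-Proper-resp-↭ (swap e e′ p) (q ∷ q′ ∷ ps) =
      Proper-resp-≅ e′ q′ ∷ Proper-resp-≅ e q ∷ All-Proper-resp-↭ p ps
    All-Proper-resp-↭ (trans p p′)  ps            = All-Proper-resp-↭ p′ (All-Proper-resp-↭ p ps)

    All-Proper-resp-≋ : ∀ {ts us} → Pointwise (_≅_ {A}) ts us → All Proper ts → All Proper us
    All-Proper-resp-≋ []       []       = []
    All-Proper-resp-≋ (e ∷ pw) (q ∷ ps) = Proper-resp-≅ e q ∷ All-Proper-resp-≋ pw ps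

  AssemblyTree-resp-≅ : ∀ {Y : Pred A 0ℓ} {s t} → s ≅ t → AssemblyTree Y s → AssemblyTree Y t
  AssemblyTree-resp-≅ e (proper , unique , complete , sound) =
    Proper-resp-≅ e proper , Unique-leaves-resp-≅ e unique ,
    (λ y y∈Y → ∈-leaves-resp-≅ e (complete y y∈Y)) ,
    (λ y y∈t → sound y (∈-leaves-resp-≅ (≅-sym e) y∈t))

  NonEmpty : Tree A → Set
  NonEmpty t = ∃[ z ] z ∈ leaves t

  Proper⇒NonEmpty : ∀ {t : Tree A} → Proper t → NonEmpty t
  Proper⇒NonEmpty (leaf {a})                = a , here ≡.refl
  Proper⇒NonEmpty (node {t ∷ ts} _ (p ∷ _)) =
    let z , z∈t = Proper⇒NonEmpty p in z , ∈-leavesL⁺ {t ∷ ts} (here ≡.refl) z∈t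

  Disjointᵗ : Tree A → Tree A → Set
  Disjointᵗ s t = Disjoint (leaves s) (leaves t)

  Disjointᵗ-sym : Symmetric Disjointᵗ
  Disjointᵗ-sym d (z∈t , z∈s) = d (z∈s , z∈t)

  Disjointᵗ-resp-≅ : Disjointᵗ Respects₂ _≅_
  Disjointᵗ-resp-≅ =
    (λ e d (z∈s , z∈t) → d (z∈s , ∈-leaves-resp-≅ (≅-sym e) z∈t)) ,
    (λ e d (z∈s , z∈t) → d (∈-leaves-resp-≅ (≅-sym e) z∈s , z∈t))

  separated-pair : ∀ {ts} → 2 ≤ length ts → All NonEmpty ts → AllPairs Disjointᵗ ts →
    ∃[ a ] ∃[ b ] a ∈ ts × b ∈ ts × NonEmpty a × NonEmpty b × Disjointᵗ a b
  separated-pair {_ ∷ []} (s≤s ())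
  separated-pair {a ∷ b ∷ _} _ (na ∷ nb ∷ _) ((a#b ∷ _) ∷ _) =
    a , b , here ≡.refl , there (here ≡.refl) , na , nb , a#b

  Unique-++⁻ : ∀ {xs ys : List A} → Unique (xs ++ ys) → Unique xs × Unique ys × Disjoint xs ys
  Unique-++⁻ {[]}     u        = [] , u , λ ()
  Unique-++⁻ {x ∷ xs} (x∉ ∷ u) =
    let uxs , uys , d = Unique-++⁻ {xs} u in
    All.tabulate (λ z∈xs → All.lookup x∉ (∈-++⁺ˡ z∈xs)) ∷ uxs , uys ,
    λ { (here ≡.refl , z∈ys) → All.lookup x∉ (∈-++⁺ʳ xs z∈ys) ≡.refl
      ; (there z∈xs , z∈ys)  → d (z∈xs , z∈ys) }

  Unique-leavesL⁻ : ∀ {ts : List (Tree A)} → Unique (leavesL ts) →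
                    All (λ t → Unique (leaves t)) ts × AllPairs Disjointᵗ ts
  Unique-leavesL⁻ {[]}     u = [] , []
  Unique-leavesL⁻ {t ∷ ts} u =
    let ut , uts , d = Unique-++⁻ {leaves t} u
        us , ds = Unique-leavesL⁻ {ts} uts in
    ut ∷ us , All.tabulate (λ s∈ts (z∈t , z∈s) → d (z∈t , ∈-leavesL⁺ s∈ts z∈s)) ∷ ds

  Unique-leavesL⁺ : ∀ {ts : List (Tree A)} → All (λ t → Unique (leaves t)) ts → AllPairs Disjointᵗ ts →
                    Unique (leavesL ts)
  Unique-leavesL⁺ {ts} us ds = subst Unique (≡.sym (leavesL-concatMap ts))
    (Uniqueₚ.concat⁺ (Allₚ.map⁺ us) (AllPairsₚ.map⁺ ds))

  -- Disjointness makes the partner of x in ys unique, so x and its partner can be cancelled.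
  ↭-by-matching : ∀ {xs ys : List (Tree A)} →
    All NonEmpty xs → AllPairs Disjointᵗ xs → AllPairs Disjointᵗ ys →
    (∀ {x} → x ∈ xs → x ∈≅ ys) → (∀ {y} → y ∈ ys → y ∈≅ xs) → Permutation _≅_ xs ys
  ↭-by-matching {[]} {[]}    _ _ _ _ _ = refl []
  ↭-by-matching {[]} {_ ∷ _} _ _ _ _ back with back (here ≡.refl)
  ... | ()
  ↭-by-matching {x ∷ xs} (nx ∷ nxs) (dx ∷ dxs) dys forth back
    with y , y∈ys , x≅y ← find (forth (here ≡.refl))
    with as , bs , ≡.refl ← ∈-∃++ y∈ys
    = trans (prep x≅y (↭-by-matching nxs dxs dys′ forth′ back′)) (≅↭.↭-sym shifted)
    where
      shifted : Permutation _≅_ (as ++ y ∷ bs) (y ∷ as ++ bs)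
      shifted = ≅↭ₚ.↭-shift as bs

      dy∷dys′ : AllPairs Disjointᵗ (y ∷ as ++ bs)
      dy∷dys′ =
        ≅↭ₚ.AllPairs-resp-↭ {R = Disjointᵗ} (λ {s t} → Disjointᵗ-sym {s} {t}) Disjointᵗ-resp-≅ shifted dys

      dys′ : AllPairs Disjointᵗ (as ++ bs)
      dys′ with _ ∷ d ← dy∷dys′ = d

      z∈y : proj₁ nx ∈ leaves y
      z∈y = ∈-leaves-resp-≅ x≅y (proj₂ nx)

      forth′ : ∀ {x′} → x′ ∈ xs → x′ ∈≅ as ++ bs
      forth′ x′∈xs with ≅↭ₚ.∈-resp-↭ shifted (forth (there x′∈xs))
      ... | here x′≅y = ⊥-elim (All.lookup dx x′∈xs (proj₂ nx , ∈-leaves-resp-≅ (≅-sym x′≅y) z∈y))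
      ... | there x′∈ = x′∈

      back′ : ∀ {y′} → y′ ∈ as ++ bs → y′ ∈≅ xs
      back′ {y′} y′∈ =
        let w , w∈ys , y′≅w = find (≅↭ₚ.∈-resp-↭ (≅↭.↭-sym shifted) (there (Any.map ≅-reflexive y′∈)))
        in from-x∷xs y′≅w (back w∈ys)
        where
          from-x∷xs : ∀ {w} → y′ ≅ w → w ∈≅ x ∷ xs → y′ ∈≅ xs
          from-x∷xs y′≅w (here w≅x) = ⊥-elim (All.lookup (AllPairs.head dy∷dys′) y′∈
            (z∈y , ∈-leaves-resp-≅ (≅-trans (≅-sym w≅x) (≅-sym y′≅w)) (proj₂ nx)))
          from-x∷xs y′≅w (there w∈) = Any.map (≅-trans y′≅w) w∈

module _ {A B : Set} (f : A → B) where

  mutual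
    leaves-mapT : (t : Tree A) → leaves (mapT f t) ≡ map f (leaves t)
    leaves-mapT (leaf a)  = ≡.refl
    leaves-mapT (node ts) = leavesL-mapTs ts

    leavesL-mapTs : (ts : List (Tree A)) → leavesL (mapTs f ts) ≡ map f (leavesL ts)
    leavesL-mapTs []       = ≡.refl
    leavesL-mapTs (t ∷ ts) = ≡.trans (cong₂ _++_ (leaves-mapT t) (leavesL-mapTs ts))
                                     (≡.sym (Listₚ.map-++ f (leaves t) (leavesL ts)))

  mapTs-map : (ts : List (Tree A)) → mapTs f ts ≡ map (mapT f) ts
  mapTs-map []       = ≡.refl
  mapTs-map (t ∷ ts) = cong (mapT f t ∷_) (mapTs-map ts)

  ∈-leaves-mapT⁺ : ∀ {t z} → z ∈ leaves t → f z ∈ leaves (mapT f t)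
  ∈-leaves-mapT⁺ {t} z∈t = subst (_ ∈_) (≡.sym (leaves-mapT t)) (∈-map⁺ f z∈t)

  ∈-leaves-mapT⁻ : ∀ {t y} → y ∈ leaves (mapT f t) → ∃[ z ] z ∈ leaves t × y ≡ f z
  ∈-leaves-mapT⁻ {t} y∈ = ∈-map⁻ f (subst (_ ∈_) (leaves-mapT t) y∈)

  mutual
    mapT-cong : ∀ {s t} → s ≅ t → mapT f s ≅ mapT f t
    mapT-cong leaf     = leaf
    mapT-cong (node p) = node (mapTs-cong p)

    mapTs-cong : ∀ {ts us} → Permutation _≅_ ts us → Permutation _≅_ (mapTs f ts) (mapTs f us)
    mapTs-cong (refl pw)     = refl (mapTs-cong-≋ pw)
    mapTs-cong (prep e p)    = prep (mapT-cong e) (mapTs-cong p)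
    mapTs-cong (swap e e′ p) = swap (mapT-cong e) (mapT-cong e′) (mapTs-cong p)
    mapTs-cong (trans p q)   = trans (mapTs-cong p) (mapTs-cong q)

    mapTs-cong-≋ : ∀ {ts us} → Pointwise _≅_ ts us → Pointwise _≅_ (mapTs f ts) (mapTs f us)
    mapTs-cong-≋ []       = []
    mapTs-cong-≋ (e ∷ pw) = mapT-cong e ∷ mapTs-cong-≋ pw

  mutual
    Proper-mapT : ∀ {t} → Proper t → Proper (mapT f t)
    Proper-mapT leaf                 = leaf
    Proper-mapT (node {ts} 2≤ ps) =
      node (subst (2 ≤_) (≡.sym (≡.trans (cong length (mapTs-map ts)) (Listₚ.length-map (mapT f) ts))) 2≤)
           (All-Proper-mapTs ps)

    All-Proper-mapTs : ∀ {ts} → All Proper ts → All Proper (mapTs f ts)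
    All-Proper-mapTs []       = []
    All-Proper-mapTs (p ∷ ps) = Proper-mapT p ∷ All-Proper-mapTs ps

module _ {A B C : Set} {f : B → C} {g : A → B} {h : A → C} where

  mutual
    mapT-∘ : (∀ x → f (g x) ≡ h x) → (t : Tree A) → mapT f (mapT g t) ≡ mapT h t
    mapT-∘ fg≗h (leaf a)  = cong leaf (fg≗h a)
    mapT-∘ fg≗h (node ts) = cong node (mapTs-∘ fg≗h ts)

    mapTs-∘ : (∀ x → f (g x) ≡ h x) → (ts : List (Tree A)) → mapTs f (mapTs g ts) ≡ mapTs h ts
    mapTs-∘ fg≗h []       = ≡.refl
    mapTs-∘ fg≗h (t ∷ ts) = cong₂ _∷_ (mapT-∘ fg≗h t) (mapTs-∘ fg≗h ts)

leaf-not-spanning : ∀ {n} {a : Fin n} → 2 ≤ n → ¬ (∀ y → y ∈ leaves (leaf a))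
leaf-not-spanning (s≤s (s≤s _)) all∈ with here ≡.refl ← all∈ zero | here () ← all∈ (suc zero)

-- Canonical representatives

module _ {A : Set} where

  first : ∀ {P : Pred A 0ℓ} → Decidable P → (xs : List A) → Any P xs → A
  first P? (x ∷ xs) P[xs] with P? x
  ... | yes _   = x
  ... | no ¬P[x] = first P? xs (Any.tail ¬P[x] P[xs])

  first-satisfies : ∀ {P : Pred A 0ℓ} (P? : Decidable P) (xs : List A) (P[xs] : Any P xs) →
                    P (first P? xs P[xs])
  first-satisfies P? (x ∷ xs) P[xs] with P? x
  ... | yes P[x] = P[x]
  ... | no ¬P[x] = first-satisfies P? xs (Any.tail ¬P[x] P[xs])

  first-cong : ∀ {P Q : Pred A 0ℓ} → P ≐ Q → (P? : Decidable P) (Q? : Decidable Q) (xs : List A)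
               (P[xs] : Any P xs) (Q[xs] : Any Q xs) → first P? xs P[xs] ≡ first Q? xs Q[xs]
  first-cong P≐Q P? Q? (x ∷ xs) P[xs] Q[xs] with P? x | Q? x
  ... | yes _    | yes _    = ≡.refl
  ... | yes P[x] | no ¬Q[x] = ⊥-elim (¬Q[x] (proj₁ P≐Q P[x]))
  ... | no ¬P[x] | yes Q[x] = ⊥-elim (¬P[x] (proj₂ P≐Q Q[x]))
  ... | no ¬P[x] | no ¬Q[x] = first-cong P≐Q P? Q? xs (Any.tail ¬P[x] P[xs]) (Any.tail ¬Q[x] Q[xs])

  AllPairs-strengthen : ∀ {P : Pred A 0ℓ} {R S : Rel A 0ℓ} {xs} → All P xs → AllPairs R xs →
                        (∀ {x y} → P x → P y → R x y → S x y) → AllPairs S xs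
  AllPairs-strengthen []         []         _ = []
  AllPairs-strengthen (px ∷ pxs) (rx ∷ rxs) f =
    All.zipWith (λ (py , r) → f px py r) (pxs , rx) ∷ AllPairs-strengthen pxs rxs f

  index-lookup : ∀ {xs : List A} {x} {i : Fin (length xs)} → Unique xs → (x∈xs : x ∈ xs) →
                 lookup xs i ≡ x → Any.index x∈xs ≡ i
  index-lookup {_ ∷ _}  {i = zero}  _         (here _)       _      = ≡.refl
  index-lookup {_ ∷ xs} {i = suc i} (x∉ ∷ _)  (here ≡.refl)  ≡.refl = ⊥-elim (All.lookup x∉ (∈-lookup i) ≡.refl)
  index-lookup {_ ∷ _}  {i = zero}  (x∉ ∷ _)  (there x∈xs)   ≡.refl = ⊥-elim (All.lookup x∉ x∈xs ≡.refl)
  index-lookup {_ ∷ _}  {i = suc i} (_ ∷ u)   (there x∈xs)   eq     = cong suc (index-lookup u x∈xs eq)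

-- Each class is represented by its least element and numbered by the position of that element in reps.
module Classes {m : ℕ} {_∼_ : Rel (Fin m) 0ℓ} (isEquivalence : IsEquivalence _∼_) (_∼?_ : Decidable₂ _∼_)
  where
  open IsEquivalence isEquivalence renaming (refl to ∼-refl; sym to ∼-sym; trans to ∼-trans)

  rep : Fin m → Fin m
  rep x = first (x ∼?_) (allFin m) (lose (∈-allFin x) ∼-refl)

  rep-∼ : ∀ x → x ∼ rep x
  rep-∼ x = first-satisfies (x ∼?_) (allFin m) _

  rep-cong : ∀ {x y} → x ∼ y → rep x ≡ rep y
  rep-cong x∼y = first-cong (∼-trans (∼-sym x∼y) , ∼-trans x∼y) _ _ (allFin m) _ _

  reps : List (Fin m)
  reps = filter (λ r → rep r ≟ r) (allFin m)

  reps-unique : Unique reps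
  reps-unique = Uniqueₚ.filter⁺ _ (Uniqueₚ.allFin⁺ m)

  rep∈reps : ∀ x → rep x ∈ reps
  rep∈reps x = ∈-filter⁺ (λ r → rep r ≟ r) (∈-allFin (rep x)) (≡.sym (rep-cong (rep-∼ x)))

  ∈reps⇒fixed : ∀ {r} → r ∈ reps → rep r ≡ r
  ∈reps⇒fixed r∈ = proj₂ (∈-filter⁻ (λ r → rep r ≟ r) {xs = allFin m} r∈)

  reps-cover : ∀ x → ∃[ r ] r ∈ reps × r ∼ x
  reps-cover x = rep x , rep∈reps x , ∼-sym (rep-∼ x)

  reps-distinct : AllPairs (λ r r′ → ¬ r ∼ r′) reps
  reps-distinct = AllPairs-strengthen (All.tabulate ∈reps⇒fixed) reps-unique
    λ r-fixed r′-fixed r≢r′ r∼r′ → r≢r′ (≡.trans (≡.sym r-fixed) (≡.trans (rep-cong r∼r′) r′-fixed))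

  #classes : ℕ
  #classes = length reps

  class : Fin m → Fin #classes
  class x = Any.index (rep∈reps x)

  classRep : Fin #classes → Fin m
  classRep = lookup reps

  classRep-class : ∀ x → classRep (class x) ≡ rep x
  classRep-class x = ≡.sym (lookup-index (rep∈reps x))

  class-unique : ∀ {x i} → rep x ≡ classRep i → class x ≡ i
  class-unique {x} eq = index-lookup reps-unique (rep∈reps x) (≡.sym eq)

  class-cong : ∀ {x y} → x ∼ y → class x ≡ class y
  class-cong {x} {y} x∼y = class-unique (≡.trans (rep-cong x∼y) (≡.sym (classRep-class y)))

  class-classRep : ∀ i → class (classRep i) ≡ i
  class-classRep i = class-unique (∈reps⇒fixed (∈-lookup i))

  class-sound : ∀ {x i} → class x ≡ i → x ∼ classRep i
  class-sound {x} ≡.refl = subst (x ∼_) (≡.sym (classRep-class x)) (rep-∼ x)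

  class-complete : ∀ {x i} → x ∼ classRep i → class x ≡ i
  class-complete {i = i} x∼r = ≡.trans (class-cong x∼r) (class-classRep i)

Fin-unique : ∀ {m} → m ≡ 1 → (i j : Fin m) → i ≡ j
Fin-unique ≡.refl zero zero = ≡.refl

concatMap-allFin-length : ∀ {B : Set} {k} (f : Fin k → List B) → (∀ i → 1 ≤ length (f i)) →
  (k ≡ 1 → ∀ i → 2 ≤ length (f i)) → Fin k → 2 ≤ length (concatMap f (allFin k))
concatMap-allFin-length {k = 1}           f _        one _ =
  subst (λ xs → 2 ≤ length xs) (≡.sym (Listₚ.++-identityʳ (f zero))) (one ≡.refl zero)
concatMap-allFin-length {k = Nat.suc (Nat.suc k)} f nonempty _   _ =
  two (f zero) (f (suc zero)) _ (nonempty zero) (nonempty (suc zero))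
  where
    two : ∀ {B : Set} (xs ys zs : List B) → 1 ≤ length xs → 1 ≤ length ys → 2 ≤ length (xs ++ ys ++ zs)
    two (_ ∷ xs) ys zs _ 1≤ys =
      s≤s (≤-trans 1≤ys (≤-trans (Listₚ.length-++-≤ˡ ys) (Listₚ.length-++-≤ʳ (ys ++ zs) {xs})))

-- Group actions on points and trees

module GroupAction (G : FiniteGroup) {n : ℕ} (A : SimpleAction G n) where
  open FiniteGroup G
  open SimpleAction A
  open IsGroup isGroup using (assoc; identityˡ; identityʳ; inverseˡ; inverseʳ)

  private
    group : Group 0ℓ 0ℓ
    group = record { isGroup = isGroup }

  open GroupProperties group using (\\-leftDividesˡ; //-rightDividesʳ; ⁻¹-involutive; ⁻¹-anti-homo-∙)
  open ≡.≡-Reasoning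

  act-inverseˡ : ∀ g x → act (g ⁻¹) (act g x) ≡ x
  act-inverseˡ g x = begin
    act (g ⁻¹) (act g x) ≡⟨ act-∙ (g ⁻¹) g x ⟨
    act ((g ⁻¹) ∙ g) x   ≡⟨ cong (λ h → act h x) (inverseˡ g) ⟩
    act ε x              ≡⟨ act-ε x ⟩
    x                    ∎

  act-inverseʳ : ∀ g x → act g (act (g ⁻¹) x) ≡ x
  act-inverseʳ g x = begin
    act g (act (g ⁻¹) x) ≡⟨ act-∙ g (g ⁻¹) x ⟨
    act (g ∙ (g ⁻¹)) x   ≡⟨ cong (λ h → act h x) (inverseʳ g) ⟩
    act ε x              ≡⟨ act-ε x ⟩
    x                    ∎

  act-injective : ∀ {g x y} → act g x ≡ act g y → x ≡ y
  act-injective {g} {x} {y} eq = begin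
    x                    ≡⟨ act-inverseˡ g x ⟨
    act (g ⁻¹) (act g x) ≡⟨ cong (act (g ⁻¹)) eq ⟩
    act (g ⁻¹) (act g y) ≡⟨ act-inverseˡ g y ⟩
    y                    ∎

  module LeftCosets {H : Pred Carrier 0ℓ} (H-subgroup : IsSubgroup H) where
    open IsSubgroup H-subgroup

    SameCoset : Rel Carrier 0ℓ
    SameCoset g g′ = H ((g ⁻¹) ∙ g′)

    sameCoset-isEquivalence : IsEquivalence SameCoset
    sameCoset-isEquivalence = record
      { refl  = λ {g} → subst H (≡.sym (inverseˡ g)) ε∈H
      ; sym   = λ {g} {g′} h → subst H
          (≡.trans (⁻¹-anti-homo-∙ (g ⁻¹) g′) (cong ((g′ ⁻¹) ∙_) (⁻¹-involutive g))) (⁻¹∈H h)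
      ; trans = λ {g} {g′} {g″} h h′ → subst H
          (≡.trans (assoc (g ⁻¹) g′ ((g′ ⁻¹) ∙ g″)) (cong ((g ⁻¹) ∙_) (\\-leftDividesˡ g′ g″))) (∙∈H h h′)
      }

    whole-if-one-coset : ∀ r → (∀ g → SameCoset r g) → ∀ g → H g
    whole-if-one-coset r r∼ g = subst H (\\-leftDividesˡ r g) (∙∈H r∈H (r∼ g))
      where
        r∈H : H r
        r∈H = subst H (⁻¹-involutive r) (⁻¹∈H (subst H (identityʳ (r ⁻¹)) (r∼ ε)))

    coset-reps-length : ∀ rs → (∀ g → ∃[ r ] r ∈ rs × SameCoset r g) → ¬ (∀ g → H g) → 2 ≤ length rs
    coset-reps-length []           cover _      with () ← proj₁ (proj₂ (cover ε))
    coset-reps-length (r ∷ [])     cover proper = ⊥-elim (proper (whole-if-one-coset r r∼))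
      where
        r∼ : ∀ g → SameCoset r g
        r∼ g with _ , here ≡.refl , h ← cover g = h
    coset-reps-length (_ ∷ _ ∷ _)  _     _      = s≤s (s≤s z≤n)

  actᵗ : Carrier → Tree (Fin n) → Tree (Fin n)
  actᵗ g = mapT (act g)

  actᵗ-∙ : ∀ g h t → actᵗ g (actᵗ h t) ≡ actᵗ (g ∙ h) t
  actᵗ-∙ g h = mapT-∘ (λ x → ≡.sym (act-∙ g h x))

  sameCoset-translates : ∀ {H τ a b} → FixedBy G A H τ → H ((a ⁻¹) ∙ b) → actᵗ a τ ≅ actᵗ b τ
  sameCoset-translates {H} {τ} {a} {b} fixed h = ≅-sym (subst (_≅ actᵗ a τ) a[a⁻¹b]τ≡bτ
    (mapT-cong (act a) (fixed ((a ⁻¹) ∙ b) h)))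
    where
      a[a⁻¹b]τ≡bτ : actᵗ a (actᵗ ((a ⁻¹) ∙ b) τ) ≡ actᵗ b τ
      a[a⁻¹b]τ≡bτ = ≡.trans (actᵗ-∙ a _ τ) (cong (λ g → actᵗ g τ) (\\-leftDividesˡ a b))

  -- x ≈ y says that the ∼-classes of x and y lie in one G-orbit. Applied below with the leaf sets of the
  -- root's children as ∼-classes, the ≈-classes are the blocks of Π.
  module InvariantEquivalence {_∼_ : Rel (Fin n) 0ℓ} (∼-isEquivalence : IsEquivalence _∼_)
           (_∼?_ : Decidable₂ _∼_) (∼-invariant : ∀ g {x y} → x ∼ y → act g x ∼ act g y) where
    open IsEquivalence ∼-isEquivalence renaming (refl to ∼-refl; sym to ∼-sym; trans to ∼-trans)

    _≈_ : Rel (Fin n) 0ℓ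
    x ≈ y = ∃[ g ] x ∼ act g y

    ∼⇒≈ : ∀ {x y} → x ∼ y → x ≈ y
    ∼⇒≈ {y = y} x∼y = ε , subst (_ ∼_) (≡.sym (act-ε y)) x∼y

    ∼-moved : ∀ g {x y} → x ∼ act g y → act (g ⁻¹) x ∼ y
    ∼-moved g {y = y} x∼gy = subst (_ ∼_) (act-inverseˡ g y) (∼-invariant (g ⁻¹) x∼gy)

    ≈-isEquivalence : IsEquivalence _≈_
    ≈-isEquivalence = record
      { refl  = ∼⇒≈ ∼-refl
      ; sym   = λ (g , x∼gy) → g ⁻¹ , ∼-sym (∼-moved g x∼gy)
      ; trans = λ {x} {y} {z} (g , x∼gy) (h , y∼hz) →
          g ∙ h , ∼-trans x∼gy (subst (act g y ∼_) (≡.sym (act-∙ g h z)) (∼-invariant g y∼hz))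
      }

    open IsEquivalence ≈-isEquivalence using () renaming (sym to ≈-sym; trans to ≈-trans)

    _≈?_ : Decidable₂ _≈_
    x ≈? y = any? (λ g → x ∼? act g y)

    ≈-act : ∀ g x → act g x ≈ x
    ≈-act g x = g , ∼-refl

    Stabilizer : Fin n → Pred Carrier 0ℓ
    Stabilizer p g = p ∼ act g p

    stabilizer-isSubgroup : ∀ p → IsSubgroup (Stabilizer p)
    stabilizer-isSubgroup p = record
      { ε∈H  = subst (p ∼_) (≡.sym (act-ε p)) ∼-refl
      ; ∙∈H  = λ {g} {h} p∼gp p∼hp →
          ∼-trans p∼gp (subst (act g p ∼_) (≡.sym (act-∙ g h p)) (∼-invariant g p∼hp))
      ; ⁻¹∈H = λ {g} p∼gp → ∼-sym (∼-moved g p∼gp) }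

    -- choose x lies in the G-orbit of x, and in the ∼-class of p when that orbit meets it (the implication
    -- keeps the choice total); being the first such point, it depends only on the orbit of x.
    module Choose (p : Fin n) where
      Chosen : Fin n → Pred (Fin n) 0ℓ
      Chosen x z = (∃[ g ] act g x ≡ z) × (x ≈ p → p ∼ z)

      chosen? : ∀ x → Decidable (Chosen x)
      chosen? x z = any? (λ g → act g x ≟ z) ×-dec ((x ≈? p) →-dec (p ∼? z))

      chosen-invariant : ∀ g x → Chosen (act g x) ≐ Chosen x
      chosen-invariant g x =
        (λ ((h , hgx≡z) , ⇒p∼z) → (h ∙ g , ≡.trans (act-∙ h g x) hgx≡z) ,
           λ x≈p → ⇒p∼z (≈-trans (≈-act g x) x≈p)) ,
        (λ ((h , hx≡z) , ⇒p∼z) →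
           (h ∙ (g ⁻¹) , ≡.trans (act-∙ h (g ⁻¹) (act g x)) (≡.trans (cong (act h) (act-inverseˡ g x)) hx≡z)) ,
           λ gx≈p → ⇒p∼z (≈-trans (≈-sym (≈-act g x)) gx≈p))

      chosen-exists : ∀ x → ∃[ z ] Chosen x z
      chosen-exists x with x ≈? p
      ... | yes (g , x∼gp) = act (g ⁻¹) x , (g ⁻¹ , ≡.refl) , λ _ → ∼-sym (∼-moved g x∼gp)
      ... | no x≉p         = x , (ε , act-ε x) , λ x≈p → ⊥-elim (x≉p x≈p)

      choose : Fin n → Fin n
      choose x = first (chosen? x) (allFin n) (lose (∈-allFin _) (proj₂ (chosen-exists x)))

      choose-chosen : ∀ x → Chosen x (choose x)
      choose-chosen x = first-satisfies (chosen? x) (allFin n) _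

      choose-invariant : ∀ g x → choose (act g x) ≡ choose x
      choose-invariant g x = first-cong (chosen-invariant g x) _ _ (allFin n) _ _

    open Classes ≈-isEquivalence _≈?_ public
      using (#classes; class; classRep; class-sound; class-complete; class-classRep; class-cong)

    class-invariant : ∀ g x → class (act g x) ≡ class x
    class-invariant g x = class-cong (≈-act g x)

    stabilizer : Fin #classes → Pred Carrier 0ℓ
    stabilizer i = Stabilizer (classRep i)

    choice : Fin #classes → Fin n → Fin n
    choice i = Choose.choose (classRep i)

    Q⇒∼ : ∀ {i z} → Qset G A class stabilizer choice i z → classRep i ∼ z
    Q⇒∼ {i} (x , ≡.refl , h , p∼hp , ≡.refl) =
      ∼-trans p∼hp (∼-invariant h (proj₂ (Choose.choose-chosen (classRep i) x) (class-sound ≡.refl)))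

    ∼⇒Q : ∀ {i z} → classRep i ∼ z → Qset G A class stabilizer choice i z
    ∼⇒Q {i} {z} p∼z with (g , gz≡c) , ⇒p∼c ← Choose.choose-chosen (classRep i) z =
      z , class-complete (∼⇒≈ (∼-sym p∼z)) , g ⁻¹ , IsSubgroup.⁻¹∈H (stabilizer-isSubgroup p) g∈H ,
      ≡.trans (cong (act (g ⁻¹)) (≡.sym gz≡c)) (act-inverseˡ g z)
      where
        p : Fin n
        p = classRep i
        g∈H : Stabilizer p g
        g∈H = ∼-trans (subst (p ∼_) (≡.sym gz≡c) (⇒p∼c (∼⇒≈ (∼-sym p∼z)))) (∼-sym (∼-invariant g p∼z))

    one-class-whole-stabilizer⇒total : #classes ≡ 1 → ∀ i → (∀ g → stabilizer i g) → ∀ z → classRep i ∼ z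
    one-class-whole-stabilizer⇒total k≡1 i whole z with g , z∼gp ← class-sound (Fin-unique k≡1 (class z) i) =
      ∼-trans (whole g) (∼-sym z∼gp)

  ∈-mapTs⁺ : ∀ {g t ts} → t ∈ ts → actᵗ g t ∈ mapTs (act g) ts
  ∈-mapTs⁺ {g} {ts = ts} t∈ts = subst (_ ∈_) (≡.sym (mapTs-map (act g) ts)) (∈-map⁺ (actᵗ g) t∈ts)

  ∈-mapTs⁻ : ∀ {g u ts} → u ∈ mapTs (act g) ts → ∃[ t ] t ∈ ts × u ≡ actᵗ g t
  ∈-mapTs⁻ {g} {ts = ts} u∈ = ∈-map⁻ (actᵗ g) (subst (_ ∈_) (mapTs-map (act g) ts) u∈)

  translates-disjoint : ∀ {g ts} → Unique (leavesL ts) → AllPairs Disjointᵗ (mapTs (act g) ts)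
  translates-disjoint {g} {ts} u = proj₂ (Unique-leavesL⁻
    (subst Unique (≡.sym (leavesL-mapTs (act g) ts)) (Uniqueₚ.map⁺ act-injective u)))

  -- Produced trees are fixed assembly trees

  module Result (D : ProcedureData G A) where
    open ProcedureData D

    Q : Fin k → Pred (Fin n) 0ℓ
    Q = Qset G A block H choice

    leaves⇒Q : ∀ {i z} → z ∈ leaves (subtree i) → Q i z
    leaves⇒Q {i} {z} = proj₂ (proj₂ (proj₂ (subtree-tree i))) z

    Q⇒leaves : ∀ {i z} → Q i z → z ∈ leaves (subtree i)
    Q⇒leaves {i} {z} = proj₁ (proj₂ (proj₂ (subtree-tree i))) z

    choice-idempotent : ∀ i x → choice i (choice i x) ≡ choice i x
    choice-idempotent i x with g , gx≡c ← choice-orbit i x =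
      subst (λ c → choice i c ≡ choice i x) gx≡c (choice-inv i g x)

    Q⇒block : ∀ {i a} → Q i a → block a ≡ i
    Q⇒block {i} (x , x∈i , h , _ , ≡.refl) with g , gx≡c ← choice-orbit i x = begin
      block (act h (choice i x)) ≡⟨ block-inv h _ ⟩
      block (choice i x)         ≡⟨ cong block gx≡c ⟨
      block (act g x)            ≡⟨ block-inv g x ⟩
      block x                    ≡⟨ x∈i ⟩
      i                          ∎

    -- The only use of simplicity of the action.
    chosen-fixed : ∀ i x x′ w → act w (choice i x) ≡ choice i x′ → w ≡ ε
    chosen-fixed i x x′ w wc≡c′ = simple w (choice i x) (≡.trans wc≡c′ (begin
      choice i x′              ≡⟨ choice-idempotent i x′ ⟨
      choice i (choice i x′)   ≡⟨ cong (choice i) wc≡c′ ⟨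
      choice i (act w (choice i x)) ≡⟨ choice-inv i w _ ⟩
      choice i (choice i x)    ≡⟨ choice-idempotent i x ⟩
      choice i x               ∎))

    Q-translate⇒H : ∀ {i a u} → Q i a → Q i (act u a) → H i u
    Q-translate⇒H {i} {a} {u} (x , _ , h , h∈H , hc≡a) (x′ , _ , h′ , h′∈H , h′c′≡ua) =
      subst (H i) (//-rightDividesʳ h u) (∙∈H (subst (H i) h′≡uh h′∈H) (⁻¹∈H h∈H))
      where
        open IsSubgroup (H-subgroup i)
        w : Carrier
        w = (h′ ⁻¹) ∙ (u ∙ h)
        wc≡c′ : act w (choice i x) ≡ choice i x′
        wc≡c′ = begin
          act w (choice i x)                      ≡⟨ act-∙ (h′ ⁻¹) (u ∙ h) _ ⟩
          act (h′ ⁻¹) (act (u ∙ h) (choice i x))  ≡⟨ cong (act (h′ ⁻¹)) (act-∙ u h _) ⟩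
          act (h′ ⁻¹) (act u (act h (choice i x))) ≡⟨ cong (λ z → act (h′ ⁻¹) (act u z)) hc≡a ⟩
          act (h′ ⁻¹) (act u a)                   ≡⟨ cong (act (h′ ⁻¹)) h′c′≡ua ⟨
          act (h′ ⁻¹) (act h′ (choice i x′))      ≡⟨ act-inverseˡ h′ _ ⟩
          choice i x′                             ∎
        h′≡uh : h′ ≡ u ∙ h
        h′≡uh = begin
          h′       ≡⟨ identityʳ h′ ⟨
          h′ ∙ ε   ≡⟨ cong (h′ ∙_) (chosen-fixed i x x′ w wc≡c′) ⟨
          h′ ∙ w   ≡⟨ \\-leftDividesˡ h′ (u ∙ h) ⟩
          u ∙ h    ∎

    translate : Fin k → Carrier → Tree (Fin n)
    translate i r = actᵗ r (subtree i)

    children : List (Tree (Fin n))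
    children = concatMap (λ i → map (translate i) (reps i)) (allFin k)

    ∈-children⁺ : ∀ {i r} → r ∈ reps i → translate i r ∈ children
    ∈-children⁺ {i} r∈ = ∈-concatMap⁺ _ (lose (∈-allFin i) (∈-map⁺ (translate i) r∈))

    ∈-children⁻ : ∀ {t} → t ∈ children → ∃[ i ] ∃[ r ] r ∈ reps i × t ≡ translate i r
    ∈-children⁻ t∈ with i , t∈i ← Any.satisfied (∈-concatMap⁻ _ {xs = allFin k} t∈)
                    with r , r∈ , ≡.refl ← ∈-map⁻ (translate i) t∈i = i , r , r∈ , ≡.refl

    translate-leaves⇒Q : ∀ {i r z} → z ∈ leaves (translate i r) → Q i (act (r ⁻¹) z)
    translate-leaves⇒Q {i} {r} z∈ with a , a∈ , ≡.refl ← ∈-leaves-mapT⁻ (act r) {subtree i} z∈ =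
      subst (Q i) (≡.sym (act-inverseˡ r a)) (leaves⇒Q a∈)

    translates-overlap⇒same-block : ∀ {i j r r′ z} → z ∈ leaves (translate i r) → z ∈ leaves (translate j r′) →
                                    i ≡ j
    translates-overlap⇒same-block {i} {j} {r} {r′} {z} z∈ z∈′ = begin
      i                     ≡⟨ Q⇒block (translate-leaves⇒Q z∈) ⟨
      block (act (r ⁻¹) z)  ≡⟨ block-inv (r ⁻¹) z ⟩
      block z               ≡⟨ block-inv (r′ ⁻¹) z ⟨
      block (act (r′ ⁻¹) z) ≡⟨ Q⇒block (translate-leaves⇒Q z∈′) ⟩
      j                     ∎

    translates-overlap⇒same-coset : ∀ {i r r′ z} → z ∈ leaves (translate i r) → z ∈ leaves (translate i r′) →
                                    H i ((r ⁻¹) ∙ r′)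
    translates-overlap⇒same-coset {i} {r} {r′} {z} z∈ z∈′ =
      Q-translate⇒H (translate-leaves⇒Q z∈′) (subst (Q i) r⁻¹r′[r′⁻¹z]≡r⁻¹z (translate-leaves⇒Q z∈))
      where
        r⁻¹r′[r′⁻¹z]≡r⁻¹z : act (r ⁻¹) z ≡ act ((r ⁻¹) ∙ r′) (act (r′ ⁻¹) z)
        r⁻¹r′[r′⁻¹z]≡r⁻¹z = ≡.sym (≡.trans (act-∙ (r ⁻¹) r′ _) (cong (act (r ⁻¹)) (act-inverseʳ r′ z)))

    coset-translates : ∀ {i a b} → H i ((a ⁻¹) ∙ b) → translate i a ≅ translate i b
    coset-translates {i} = sameCoset-translates (subtree-fixed i)

    children-disjoint : AllPairs Disjointᵗ children
    children-disjoint = AllPairsₚ.concat⁺ {xss = map (λ i → map (translate i) (reps i)) (allFin k)}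
      (Allₚ.map⁺ (All.tabulate λ {i} _ → AllPairsₚ.map⁺
        (AllPairs.map (λ ¬same {_} (z∈ , z∈′) → ¬same (translates-overlap⇒same-coset z∈ z∈′))
          (reps-distinct i))))
      (AllPairsₚ.map⁺ (AllPairsₚ.tabulate⁺ {f = λ i → i} λ i≢j →
        Allₚ.map⁺ (All.tabulate λ _ → Allₚ.map⁺ (All.tabulate λ _ {_} (z∈ , z∈′) →
          i≢j (translates-overlap⇒same-block z∈ z∈′)))))

    children-proper : All Proper children
    children-proper = All.tabulate λ t∈ → case ∈-children⁻ t∈ of
      λ { (i , r , _ , ≡.refl) → Proper-mapT (act r) (proj₁ (subtree-tree i)) }

    children-unique : All (λ t → Unique (leaves t)) children
    children-unique = All.tabulate λ t∈ → case ∈-children⁻ t∈ of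
      λ { (i , r , _ , ≡.refl) → subst Unique (≡.sym (leaves-mapT (act r) (subtree i)))
                                   (Uniqueₚ.map⁺ act-injective (proj₁ (proj₂ (subtree-tree i)))) }

    children-cover : ∀ y → y ∈ leavesL children
    children-cover y with g , gy≡c ← choice-orbit (block y) y
                     with r , r∈ , h ← reps-cover (block y) (g ⁻¹) =
      ∈-leavesL⁺ (∈-children⁺ r∈) (subst (_∈ leaves (translate i r)) r[r⁻¹g⁻¹c]≡y
        (∈-leaves-mapT⁺ (act r) {subtree i} (Q⇒leaves (y , ≡.refl , _ , h , ≡.refl))))
      where
        i : Fin k
        i = block y
        c : Fin n
        c = choice i y
        r[r⁻¹g⁻¹c]≡y : act r (act ((r ⁻¹) ∙ (g ⁻¹)) c) ≡ y
        r[r⁻¹g⁻¹c]≡y = begin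
          act r (act ((r ⁻¹) ∙ (g ⁻¹)) c) ≡⟨ act-∙ r _ c ⟨
          act (r ∙ ((r ⁻¹) ∙ (g ⁻¹))) c   ≡⟨ cong (λ h → act h c) (\\-leftDividesˡ r (g ⁻¹)) ⟩
          act (g ⁻¹) c                     ≡⟨ cong (act (g ⁻¹)) gy≡c ⟨
          act (g ⁻¹) (act g y)             ≡⟨ act-inverseˡ g y ⟩
          y                                ∎

    children-length : 2 ≤ n → 2 ≤ length children
    children-length (s≤s _) = concatMap-allFin-length _
      (λ i → subst (1 ≤_) (≡.sym (Listₚ.length-map (translate i) (reps i))) (reps-nonempty i))
      (λ k≡1 i → subst (2 ≤_) (≡.sym (Listₚ.length-map (translate i) (reps i)))
        (LeftCosets.coset-reps-length (H-subgroup i) (reps i) (reps-cover i) (H-proper k≡1 i)))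
      (block zero)
      where
        reps-nonempty : ∀ i → 1 ≤ length (reps i)
        reps-nonempty i with _ , r∈ , _ ← reps-cover i ε = ∈-length r∈

    children-leaves-unique : Unique (leavesL children)
    children-leaves-unique = Unique-leavesL⁺ children-unique children-disjoint

    result-assemblyTree : 2 ≤ n → AssemblyTree (AllX G A) result
    result-assemblyTree 2≤n =
      node (children-length 2≤n) children-proper , children-leaves-unique , (λ y _ → children-cover y) , (λ _ _ → tt)

    result-fixed : FixedBy G A (AllG G A) result
    result-fixed g _ =
      node (↭-by-matching nonempty (translates-disjoint children-leaves-unique) children-disjoint forth back)
      where
        nonempty : All NonEmpty (mapTs (act g) children)
        nonempty = All.tabulate λ u∈ → case ∈-mapTs⁻ u∈ of
          λ { (t , t∈ , ≡.refl) → Proper⇒NonEmpty (Proper-mapT (act g) (All.lookup children-proper t∈)) }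

        forth : ∀ {u} → u ∈ mapTs (act g) children → u ∈≅ children
        forth u∈ with t , t∈ , ≡.refl ← ∈-mapTs⁻ u∈
                 with i , r , _ , ≡.refl ← ∈-children⁻ t∈
                 with r′ , r′∈ , h ← reps-cover i (g ∙ r) =
          lose (∈-children⁺ r′∈) (subst (_≅ translate i r′) (≡.sym (actᵗ-∙ g r (subtree i)))
                                        (≅-sym (coset-translates h)))

        back : ∀ {t} → t ∈ children → t ∈≅ mapTs (act g) children
        back t∈ with i , r , _ , ≡.refl ← ∈-children⁻ t∈
                with r′ , r′∈ , h ← reps-cover i ((g ⁻¹) ∙ r) =
          lose (∈-mapTs⁺ (∈-children⁺ r′∈)) (subst (_≅ actᵗ g (translate i r′)) g[g⁻¹r]≡r
            (mapT-cong (act g) (≅-sym (coset-translates h))))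
          where
            g[g⁻¹r]≡r : actᵗ g (translate i ((g ⁻¹) ∙ r)) ≡ translate i r
            g[g⁻¹r]≡r = ≡.trans (actᵗ-∙ g _ (subtree i)) (cong (λ h → actᵗ h (subtree i)) (\\-leftDividesˡ g r))

  -- Fixed assembly trees are produced

  module Decomposition (ts : List (Tree (Fin n))) (two-children : 2 ≤ length ts) (proper : All Proper ts)
           (unique : Unique (leavesL ts)) (cover : ∀ y → y ∈ leavesL ts)
           (fixed : ∀ g → Permutation _≅_ (mapTs (act g) ts) ts) where
    open import Data.List.Membership.DecPropositional (_≟_ {n}) using (_∈?_)

    child : Fin n → Tree (Fin n)
    child z = proj₁ (∈-leavesL⁻ {ts = ts} (cover z))

    child-∈ : ∀ z → child z ∈ ts
    child-∈ z = proj₁ (proj₂ (∈-leavesL⁻ {ts = ts} (cover z)))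

    ∈-child : ∀ z → z ∈ leaves (child z)
    ∈-child z = proj₂ (proj₂ (∈-leavesL⁻ {ts = ts} (cover z)))

    ts-disjoint : AllPairs Disjointᵗ ts
    ts-disjoint = proj₂ (Unique-leavesL⁻ unique)

    child-unique : ∀ {t z} → t ∈ ts → z ∈ leaves t → t ≡ child z
    child-unique {z = z} t∈ z∈t with ∈-AllPairs₂ ts-disjoint t∈ (child-∈ z)
    ... | inj₁ t≡child = t≡child
    ... | inj₂ (inj₁ disjoint) = ⊥-elim (disjoint (z∈t , ∈-child z))
    ... | inj₂ (inj₂ disjoint) = ⊥-elim (disjoint (∈-child z , z∈t))

    _∼_ : Rel (Fin n) 0ℓ
    z ∼ w = w ∈ leaves (child z)

    ∼⇒child≡ : ∀ {z w} → z ∼ w → child z ≡ child w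
    ∼⇒child≡ {z} z∼w = child-unique (child-∈ z) z∼w

    ∼-isEquivalence : IsEquivalence _∼_
    ∼-isEquivalence = record
      { refl  = λ {z} → ∈-child z
      ; sym   = λ {z} {w} z∼w → subst (λ t → z ∈ leaves t) (∼⇒child≡ z∼w) (∈-child z)
      ; trans = λ {z} {w} {v} z∼w w∼v → subst (λ t → v ∈ leaves t) (≡.sym (∼⇒child≡ z∼w)) w∼v
      }

    _∼?_ : Decidable₂ _∼_
    z ∼? w = w ∈? leaves (child z)

    translate-child : ∀ g z → actᵗ g (child z) ≅ child (act g z)
    translate-child g z
      with t , t∈ , gchild≅t ← find (≅↭ₚ.∈-resp-↭ (fixed g) (lose (∈-mapTs⁺ (child-∈ z)) ≅-refl)) =
      subst (actᵗ g (child z) ≅_)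
        (child-unique t∈ (∈-leaves-resp-≅ gchild≅t (∈-leaves-mapT⁺ (act g) {child z} (∈-child z)))) gchild≅t

    ∼-invariant : ∀ g {z w} → z ∼ w → act g z ∼ act g w
    ∼-invariant g {z} z∼w = ∈-leaves-resp-≅ (translate-child g z) (∈-leaves-mapT⁺ (act g) {child z} z∼w)

    not-one-child : ∀ p → ¬ (∀ z → p ∼ z)
    not-one-child p all∼
      with a , b , a∈ , b∈ , (za , za∈a) , (zb , zb∈b) , a#b
             ← separated-pair {ts = ts} two-children (All.map Proper⇒NonEmpty proper) ts-disjoint
      = a#b (subst (λ t → zb ∈ leaves t) p-child≡a (all∼ zb) , zb∈b)
      where
        p-child≡a : child p ≡ a
        p-child≡a = ≡.trans (∼⇒child≡ (all∼ za)) (≡.sym (child-unique a∈ za∈a))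

    open InvariantEquivalence ∼-isEquivalence _∼?_ ∼-invariant

    stabilizer-fixes : ∀ {i g} → stabilizer i g → actᵗ g (child (classRep i)) ≅ child (classRep i)
    stabilizer-fixes {i} {g} p∼gp =
      subst (actᵗ g (child (classRep i)) ≅_) (≡.sym (∼⇒child≡ p∼gp)) (translate-child g (classRep i))

    module CosetReps (i : Fin #classes) = Classes
      (LeftCosets.sameCoset-isEquivalence (stabilizer-isSubgroup (classRep i)))
      (λ g g′ → classRep i ∼? act ((g ⁻¹) ∙ g′) (classRep i))

    procedure : ProcedureData G A
    procedure = record
      { k              = #classes
      ; block          = class
      ; block-inv      = class-invariant
      ; block-nonempty = λ i → classRep i , class-classRep i
      ; H              = stabilizer
      ; H-subgroup     = λ i → stabilizer-isSubgroup (classRep i)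
      ; H-proper       = λ k≡1 i whole → not-one-child (classRep i) (one-class-whole-stabilizer⇒total k≡1 i whole)
      ; choice         = choice
      ; choice-orbit   = λ i x → proj₁ (Choose.choose-chosen (classRep i) x)
      ; choice-inv     = λ i → Choose.choose-invariant (classRep i)
      ; subtree        = λ i → child (classRep i)
      ; subtree-tree   = λ i → All.lookup proper (child-∈ (classRep i)) ,
                               All.lookup (proj₁ (Unique-leavesL⁻ unique)) (child-∈ (classRep i)) ,
                               (λ z → Q⇒∼) , (λ z → ∼⇒Q)
      ; subtree-fixed  = λ i g → stabilizer-fixes
      ; reps           = CosetReps.reps
      ; reps-cover     = CosetReps.reps-cover
      ; reps-distinct  = CosetReps.reps-distinct
      }

    ∈ts≅translate : ∀ {t z g p} → t ∈ ts → z ∈ leaves t → z ∼ act g p → t ≅ actᵗ g (child p)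
    ∈ts≅translate {g = g} {p} t∈ z∈t z∼gp = subst (_≅ actᵗ g (child p))
      (≡.trans (≡.sym (∼⇒child≡ z∼gp)) (≡.sym (child-unique t∈ z∈t))) (≅-sym (translate-child g p))

    node≅result : node ts ≅ ProcedureData.result procedure
    node≅result = node (↭-by-matching (All.map Proper⇒NonEmpty proper) ts-disjoint R.children-disjoint forth back)
      where
        module R = Result procedure

        forth : ∀ {t} → t ∈ ts → t ∈≅ R.children
        forth {t} t∈ =
          let z , z∈t    = Proper⇒NonEmpty (All.lookup proper t∈)
              g , z∼gp   = class-sound {z} ≡.refl
              r , r∈ , h = CosetReps.reps-cover (class z) g
          in lose (R.∈-children⁺ r∈) (≅-trans (∈ts≅translate t∈ z∈t z∼gp) (≅-sym (R.coset-translates h)))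

        back : ∀ {u} → u ∈ R.children → u ∈≅ ts
        back u∈ = let i , r , _ , u≡ = R.∈-children⁻ u∈ ; p = classRep i in
          lose (child-∈ (act r p)) (subst (_≅ child (act r p)) (≡.sym u≡) (translate-child r p))

  produced⇒fixed-assemblyTree : 2 ≤ n → ∀ {τ} → Produced G A τ →
                                AssemblyTree (AllX G A) τ × FixedBy G A (AllG G A) τ
  produced⇒fixed-assemblyTree 2≤n (D , τ≅result) =
    AssemblyTree-resp-≅ (≅-sym τ≅result) (result-assemblyTree 2≤n) ,
    λ g _ → ≅-trans (mapT-cong (act g) τ≅result) (≅-trans (result-fixed g _) (≅-sym τ≅result))
    where open Result D

  fixed-assemblyTree⇒produced : 2 ≤ n → ∀ τ → AssemblyTree (AllX G A) τ → FixedBy G A (AllG G A) τ →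
                                Produced G A τ
  fixed-assemblyTree⇒produced 2≤n (leaf a)  (_ , _ , spanning , _) _ =
    ⊥-elim (leaf-not-spanning 2≤n (λ y → spanning y tt))
  fixed-assemblyTree⇒produced _   (node ts) (node 2≤ proper , unique , spanning , _) fixed =
    procedure , node≅result
    where open Decomposition ts 2≤ proper unique (λ y → spanning y tt) (λ g → node-≅⁻ (fixed g tt))

theorem4p4 : (G : FiniteGroup) (n : ℕ) (A : SimpleAction G n) → 2 ≤ n →
    (τ : Tree (Fin n)) →
    (Produced G A τ → AssemblyTree (AllX G A) τ × FixedBy G A (AllG G A) τ) ×
    (AssemblyTree (AllX G A) τ → FixedBy G A (AllG G A) τ → Produced G A τ)
theorem4p4 G n A 2≤n τ =
  GroupAction.produced⇒fixed-assemblyTree G A 2≤n , GroupAction.fixed-assemblyTree⇒produced G A 2≤n τ
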